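{- Let $M$ be a thread-register model and $\mathcal B$ a set of thread-local actions of $M$. A path $\pi$ of $M$ starting in the initial state of $M$ is $\mathcal B$-$\smile_T$-just if and only if $\pi$ thread-enables no action $a\notin\mathcal B$.
   Context: An LTS is a tuple $(S,\mathit{Act},\mathit{init},\mathit{Trans})$ with finite $S$, finite $\mathit{Act}$, $\mathit{init}\in S$, $\mathit{Trans}\subseteq S\times\mathit{Act}\times S$; $a$ is enabled in $s$ if $(s,a,s')\in\mathit{Trans}$ for some $s'$. A path is a nonempty finite or infinite alternating sequence $s_0a_1s_1a_2\ldots$ with $(s_i,a_{i+1},s_{i+1})\in\mathit{Trans}$, ending in a state if finite; a suffix of a path is a path obtained by removing an initial segment ending in a state. The parallel composition of LTSs $P_i=(S_i,\mathit{Act}_i,\mathit{init}_i,\mathit{Trans}_i)$, $i=1..k$, has states $S_1\times\cdots\times S_k$, actions $\bigcup_i\mathit{Act}_i$, initial state $(\mathit{init}_i)_i$, and a transition $((s_i)_i,a,(s'_i)_i)$ iff for every $i$: $s'_i=s_i$ if $a\notin\mathit{Act}_i$, and $(s_i,a,s'_i)\in\mathit{Trans}_i$ if $a\in\mathit{Act}_i$. Registers. Fix disjoint finite sets $\mathbb T$ (thread ids) and $\mathbb R$ (register ids); each $r\in\mathbb R$ has a finite domain $D_r$ and initial value $d^0_r$. For $t\in\mathbb T$, $r\in\mathbb R$, $d\in D_r$ the register actions are $\mathit{sr}_{t,r}$, $\mathit{fr}_{t,r}(d)$, $\mathit{sw}_{t,r}(d)$, $\mathit{fw}_{t,r}$ (interface)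 and $\mathit{or}_{t,r}$, $\mathit{ow}_{t,r}$ (register-local). States of a register LTS for $r$ are statuses $s$ with components $\mathit{stor}(s)\in D_r$, $\mathit{rds}(s),\mathit{wrts}(s),\mathit{pend}(s)\subseteq\mathbb T$, and per $t$: $\mathit{rec}(s,t)\in D_r$, $\mathit{ovrl}(s,t)\in\{\mathit{true},\mathit{false}\}$, $\mathit{posv}(s,t)\subseteq D_r$; initially $\mathit{stor}=d^0_r$, $\mathit{rds}=\mathit{wrts}=\mathit{pend}=\emptyset$, $\mathit{rec}(t)=d^0_r$, $\mathit{ovrl}(t)=\mathit{false}$, $\mathit{posv}(t)=\emptyset$. Updates (unmentioned components unchanged, right sides evaluated in $s$): $\mathit{usr}(s,t)$: add $t$ to $\mathit{rds},\mathit{pend}$; $\mathit{ovrl}(t):=(\mathit{wrts}(s)\neq\emptyset)$; $\mathit{posv}(t):=\{\mathit{stor}(s)\}\cup\{\mathit{rec}(s,t'):t'\in\mathit{wrts}(s)\}$. $\mathit{ufr}(s,t)$: remove $t$ from $\mathit{rds}$. $\mathit{usw}(s,t,d)$: add $t$ to $\mathit{wrts},\mathit{pend}$; $\mathit{rec}(t):=d$; $\mathit{ovrl}(t):=(\mathit{wrts}(s)\neq\emptyset)$; for all $t'\neq t$: $\mathit{ovrl}(t'):=\mathit{true}$, $\mathit{posv}(t'):=\mathit{posv}(s,t')\cup\{d\}$. $\mathit{ufw}(s,t,d)$: $\mathit{stor}:=d$, remove $t$ from $\mathit{wrts}$. $\mathit{uor}(s,t)$: remove $t$ from $\mathit{pend}$,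 $\mathit{rec}(t):=\mathit{stor}(s)$. $\mathit{uow}(s,t,d)$: $\mathit{stor}:=d$, remove $t$ from $\mathit{pend}$. In each register LTS, for all $s,t,d$: if $t\notin\mathit{rds}(s)\cup\mathit{wrts}(s)$, transitions $s\xrightarrow{\mathit{sr}_{t,r}}\mathit{usr}(s,t)$ and $s\xrightarrow{\mathit{sw}_{t,r}(d)}\mathit{usw}(s,t,d)$; further: Safe: $t\in\mathit{rds}(s)$, $\neg\mathit{ovrl}(s,t)$: $\mathit{fr}_{t,r}(\mathit{stor}(s))$ to $\mathit{ufr}(s,t)$; $t\in\mathit{rds}(s)$, $\mathit{ovrl}(s,t)$: $\mathit{fr}_{t,r}(d)$ to $\mathit{ufr}(s,t)$; $t\in\mathit{wrts}(s)$, $\neg\mathit{ovrl}(s,t)$: $\mathit{fw}_{t,r}$ to $\mathit{ufw}(s,t,\mathit{rec}(s,t))$; $t\in\mathit{wrts}(s)$, $\mathit{ovrl}(s,t)$: $\mathit{fw}_{t,r}$ to $\mathit{ufw}(s,t,d)$. Regular: $t\in\mathit{rds}(s)$, $d\in\mathit{posv}(s,t)$: $\mathit{fr}_{t,r}(d)$ to $\mathit{ufr}(s,t)$; $t\in\mathit{wrts}(s)\cap\mathit{pend}(s)$: $\mathit{ow}_{t,r}$ to $\mathit{uow}(s,t,\mathit{rec}(s,t))$; $t\in\mathit{wrts}(s)\setminus\mathit{pend}(s)$: $\mathit{fw}_{t,r}$ to $\mathit{ufw}(s,t,\mathit{stor}(s))$. Atomic: $t\in\mathit{rds}(s)\cap\mathit{pend}(s)$: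 $\mathit{or}_{t,r}$ to $\mathit{uor}(s,t)$; $t\in\mathit{wrts}(s)\cap\mathit{pend}(s)$: $\mathit{ow}_{t,r}$ to $\mathit{uow}(s,t,\mathit{rec}(s,t))$; $t\in\mathit{rds}(s)\setminus\mathit{pend}(s)$: $\mathit{fr}_{t,r}(\mathit{rec}(s,t))$ to $\mathit{ufr}(s,t)$; $t\in\mathit{wrts}(s)\setminus\mathit{pend}(s)$: $\mathit{fw}_{t,r}$ to $\mathit{ufw}(s,t,\mathit{stor}(s))$. Threads. Each $t\in\mathbb T$ has a thread LTS $T_t$ with actions $\{\mathit{sr}_{t,r},\mathit{fr}_{t,r}(d),\mathit{sw}_{t,r}(d),\mathit{fw}_{t,r}:r\in\mathbb R,d\in D_r\}\cup\mathit{TLoc}_t$, the thread-local sets $\mathit{TLoc}_t$ pairwise disjoint and disjoint from register actions; on every path from its initial state, each $\mathit{sr}_{t,r}$-transition leads to a state where exactly the $\mathit{fr}_{t,r}(d)$, $d\in D_r$, are enabled, each $\mathit{sw}_{t,r}(d)$-transition leads to a state where only $\mathit{fw}_{t,r}$ is enabled, and $\mathit{fr}_{t,r}(d)$, $\mathit{fw}_{t,r}$ are enabled only in such states. A thread-register model $M$ is the parallel composition of all $T_t$ and one safe, regular or atomic register LTS per $r\in\mathbb R$; for a state $s$ of $M$, $s_t$ denotes its component in $T_t$. It has maps $\mathit{thr}(a)=t$ for every action indexed by $t$ (thread-local actions of $\mathit{TLoc}_t$ included) and $\mathit{reg}(a)=r$ for register actions of $r$, $\mathit{reg}(a)=\bot$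 for thread-local actions. Justness. $\smile_T=\{(a,b):\mathit{thr}(a)\neq\mathit{thr}(b)\}$. For a relation $\smile$ and a set $\mathcal B$ of actions, a path $\pi$ is $\mathcal B$-$\smile$-just if for every suffix $\pi'$ of $\pi$ and every action $a\notin\mathcal B$ enabled in the first state of $\pi'$, some action $b$ with $\neg(a\smile b)$ occurs in $\pi'$. Thread-enabling. For a path $\pi$ of $M$ from its initial state and $t\in\mathbb T$, if $\pi$ has a suffix on which no action $b$ with $\mathit{thr}(b)=t$ occurs, then the $T_t$-component of all states on that suffix is the same state, denoted $\mathit{end}_t(\pi)$. An action $a$ is thread-enabled by $\pi$ if, for $t=\mathit{thr}(a)$, $\pi$ contains only finitely many actions $b$ with $\mathit{thr}(b)=t$ and $a$ is enabled in the state $\mathit{end}_t(\pi)$ of $T_t$. -}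

module Defs where

open import Data.Nat using (ℕ; zero; suc; _+_; _∸_; _≤_; _<_; s≤s)
open import Data.Fin using (Fin; _≟_)
open import Data.Fin.Subset using (Subset; inside; outside; _∈_; _∉_; _∪_; ⁅_⁆)
open import Data.Vec using (Vec; []; _∷_; lookup; tabulate; _[_]≔_)
open import Data.Bool using (Bool; true; false; _∨_; _∧_; if_then_else_)
open import Data.Maybe using (Maybe; just; nothing)
open import Data.Product using (Σ; Σ-syntax; _×_; _,_)
open import Data.Sum using (_⊎_; inj₁; inj₂)
open import Data.Unit using (⊤)
open import Data.Empty using (⊥)
open import Relation.Nullary using (¬_; does)
open import Relation.Binary.PropositionalEquality using (_≡_; _≢_; subst)
open import Data.Nat.Properties using (+-comm)
open import Function.Bundles using (_⇔_)

-- Generic labelled transition systems over an action universe A.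
-- The action set Act of an LTS is the predicate Alph on A.

record LTS (A : Set) : Set₁ where
  field
    State  : Set
    init   : State
    Alph   : A → Set
    Trans  : State → A → State → Set
    trans⊆ : ∀ {s a s'} → Trans s a s' → Alph a

open LTS public

Enabled : ∀ {A} (L : LTS A) → State L → A → Set
Enabled L s a = Σ[ s' ∈ State L ] Trans L s a s'

Par : ∀ {A} {I : Set} → (I → LTS A) → LTS A
Par {A} {I} P = record
  { State  = (i : I) → State (P i)
  ; init   = λ i → init (P i)
  ; Alph   = λ a → Σ[ i ∈ I ] Alph (P i) a
  ; Trans  = λ s a s' → (Σ[ i ∈ I ] Alph (P i) a)
                       × ((i : I) → (¬ Alph (P i) a → s' i ≡ s i)
                                  × (Alph (P i) a → Trans (P i) (s i) a (s' i)))
  ; trans⊆ = λ tr → Data.Product.proj₁ tr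
  }

-- A path with len = fin n has the
-- states st 0 .. st n and actions act 0 .. act (n-1), where act i is the
-- action of the step from st i to st (suc i).  Values of st/act beyond the length are irrelevant.

data Len : Set where
  fin : ℕ → Len
  inf : Len

_<ᴸ_ : ℕ → Len → Set
i <ᴸ fin n = i < n
i <ᴸ inf   = ⊤

_≤ᴸ_ : ℕ → Len → Set
i ≤ᴸ fin n = i ≤ n
i ≤ᴸ inf   = ⊤

_∸ᴸ_ : Len → ℕ → Len
fin n ∸ᴸ k = fin (n ∸ k)
inf   ∸ᴸ k = inf

record Path {A} (L : LTS A) : Set where
  field
    len  : Len
    st   : ℕ → State L
    act  : ℕ → A
    step : ∀ i → i <ᴸ len → Trans L (st i) (act i) (st (suc i))

open Path public

private
  <∸⇒+< : ∀ k n i → i < n ∸ k → k + i < n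
  <∸⇒+< zero    n       i p = p
  <∸⇒+< (suc k) zero    i ()
  <∸⇒+< (suc k) (suc n) i p = s≤s (<∸⇒+< k n i p)

  shift< : ∀ k (l : Len) i → i <ᴸ (l ∸ᴸ k) → (i + k) <ᴸ l
  shift< k (fin n) i p = subst (_< n) (+-comm k i) (<∸⇒+< k n i p)
  shift< k inf     i p = p

suffix : ∀ {A} {L : LTS A} (π : Path L) (k : ℕ) → k ≤ᴸ len π → Path L
suffix π k _ = record
  { len  = len π ∸ᴸ k
  ; st   = λ i → st π (i + k)
  ; act  = λ i → act π (i + k)
  ; step = λ i p → step π (i + k) (shift< k (len π) i p)
  }

-- "some action satisfying P occurs in π" (read classically: it is not
-- the case that no action on π satisfies P); and "no action satisfying P
-- occurs in π".
NoneOn : ∀ {A} {L : LTS A} → Path L → (A → Set) → Set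
NoneOn π P = ∀ j → j <ᴸ len π → ¬ P (act π j)

Occurs : ∀ {A} {L : LTS A} → Path L → (A → Set) → Set
Occurs π P = ¬ NoneOn π P

Just : ∀ {A} {L : LTS A} → (A → A → Set) → (A → Set) → Path L → Set
Just {L = L} _⌣_ B π =
  ∀ k (k≤ : k ≤ᴸ len π) → let π' = suffix π k k≤ in
  ∀ a → ¬ B a → Enabled L (st π' 0) a → Occurs π' (λ b → ¬ (a ⌣ b))

-- Thread-register setting: thread ids 𝕋 = Fin nT, register ids
-- ℝ = Fin nR, register domains D r = Fin (dsz r) with initial values d0 r,
-- thread-local action sets TLoc_t = Fin (nLoc t) (tagged by t, so pairwise
-- disjoint and disjoint from register actions).

record Setting : Set where
  field
    nT   : ℕ
    nR   : ℕ
    dsz  : Fin nR → ℕ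
    d0   : (r : Fin nR) → Fin (dsz r)
    nLoc : Fin nT → ℕ

data Kind : Set where
  safe regular atomic : Kind

module TR (σ : Setting) where
  open Setting σ

  𝕋 ℝ : Set
  𝕋 = Fin nT
  ℝ = Fin nR

  D : ℝ → Set
  D r = Fin (dsz r)

  data Action : Set where
    sr : (t : 𝕋) (r : ℝ) → Action
    fr : (t : 𝕋) (r : ℝ) → D r → Action
    sw : (t : 𝕋) (r : ℝ) → D r → Action
    fw : (t : 𝕋) (r : ℝ) → Action
    or : (t : 𝕋) (r : ℝ) → Action
    ow : (t : 𝕋) (r : ℝ) → Action
    loc : (t : 𝕋) → Fin (nLoc t) → Action

  thr : Action → 𝕋
  thr (sr t _)   = t
  thr (fr t _ _) = t
  thr (sw t _ _) = t
  thr (fw t _)   = t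
  thr (or t _)   = t
  thr (ow t _)   = t
  thr (loc t _)  = t

  reg : Action → Maybe ℝ
  reg (sr _ r)   = just r
  reg (fr _ r _) = just r
  reg (sw _ r _) = just r
  reg (fw _ r)   = just r
  reg (or _ r)   = just r
  reg (ow _ r)   = just r
  reg (loc _ _)  = nothing

  ThreadLocal : Action → Set
  ThreadLocal (loc _ _) = ⊤
  ThreadLocal _         = ⊥

  _⌣T_ : Action → Action → Set
  a ⌣T b = thr a ≢ thr b

  record Status (r : ℝ) : Set where
    field
      stor : D r
      rds wrts pend : Subset nT
      recv : Vec (D r) nT
      ovrl : Vec Bool nT
      posv : Vec (Subset (dsz r)) nT
  open Status

  nonEmpty : ∀ {n} → Subset n → Bool
  nonEmpty []       = false
  nonEmpty (x ∷ xs) = x ∨ nonEmpty xs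

  anyFin : ∀ {n} → (Fin n → Bool) → Bool
  anyFin {zero}  f = false
  anyFin {suc n} f = f Fin.zero ∨ anyFin (λ i → f (Fin.suc i))

  eqᵇ : ∀ {n} → Fin n → Fin n → Bool
  eqᵇ i j = does (i ≟ j)

  initStatus : (r : ℝ) → Status r
  initStatus r = record
    { stor = d0 r ; rds = tabulate (λ _ → outside) ; wrts = tabulate (λ _ → outside)
    ; pend = tabulate (λ _ → outside) ; recv = tabulate (λ _ → d0 r)
    ; ovrl = tabulate (λ _ → false) ; posv = tabulate (λ _ → tabulate (λ _ → outside)) }

  module _ {r : ℝ} where
    usr : Status r → 𝕋 → Status r
    usr s t = record s
      { rds  = rds s [ t ]≔ inside
      ; pend = pend s [ t ]≔ inside
      ; ovrl = ovrl s [ t ]≔ nonEmpty (wrts s)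
      ; posv = posv s [ t ]≔ (⁅ stor s ⁆ ∪ tabulate (λ d → anyFin (λ t' →
                   lookup (wrts s) t' ∧ eqᵇ (lookup (recv s) t') d)))
      }

    ufr : Status r → 𝕋 → Status r
    ufr s t = record s { rds = rds s [ t ]≔ outside }

    usw : Status r → 𝕋 → D r → Status r
    usw s t d = record s
      { wrts = wrts s [ t ]≔ inside
      ; pend = pend s [ t ]≔ inside
      ; recv = recv s [ t ]≔ d
      ; ovrl = tabulate (λ t' → if eqᵇ t' t then nonEmpty (wrts s) else true)
      ; posv = tabulate (λ t' → if eqᵇ t' t then lookup (posv s) t'
                                 else (lookup (posv s) t' ∪ ⁅ d ⁆))
      }

    ufw : Status r → 𝕋 → D r → Status r
    ufw s t d = record s { stor = d ; wrts = wrts s [ t ]≔ outside }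

    uor : Status r → 𝕋 → Status r
    uor s t = record s { pend = pend s [ t ]≔ outside ; recv = recv s [ t ]≔ stor s }

    uow : Status r → 𝕋 → D r → Status r
    uow s t d = record s { stor = d ; pend = pend s [ t ]≔ outside }

  rec : ∀ {r} → Status r → 𝕋 → D r
  rec s t = lookup (recv s) t

  ovrlOf : ∀ {r} → Status r → 𝕋 → Bool
  ovrlOf s t = lookup (ovrl s) t

  posvOf : ∀ {r} → Status r → 𝕋 → Subset _
  posvOf s t = lookup (posv s) t

  data RegTrans (r : ℝ) : Kind → Status r → Action → Status r → Set where
    start-r : ∀ {k s t} → t ∉ rds s → t ∉ wrts s → RegTrans r k s (sr t r) (usr s t)
    start-w : ∀ {k s t d} → t ∉ rds s → t ∉ wrts s → RegTrans r k s (sw t r d) (usw s t d)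
    safe-fr₁ : ∀ {s t} → t ∈ rds s → ovrlOf s t ≡ false →
               RegTrans r safe s (fr t r (stor s)) (ufr s t)
    safe-fr₂ : ∀ {s t d} → t ∈ rds s → ovrlOf s t ≡ true →
               RegTrans r safe s (fr t r d) (ufr s t)
    safe-fw₁ : ∀ {s t} → t ∈ wrts s → ovrlOf s t ≡ false →
               RegTrans r safe s (fw t r) (ufw s t (rec s t))
    safe-fw₂ : ∀ {s t d} → t ∈ wrts s → ovrlOf s t ≡ true →
               RegTrans r safe s (fw t r) (ufw s t d)
    reg-fr : ∀ {s t d} → t ∈ rds s → d ∈ posvOf s t →
             RegTrans r regular s (fr t r d) (ufr s t)
    reg-ow : ∀ {s t} → t ∈ wrts s → t ∈ pend s →
             RegTrans r regular s (ow t r) (uow s t (rec s t))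
    reg-fw : ∀ {s t} → t ∈ wrts s → t ∉ pend s →
             RegTrans r regular s (fw t r) (ufw s t (stor s))
    atom-or : ∀ {s t} → t ∈ rds s → t ∈ pend s →
              RegTrans r atomic s (or t r) (uor s t)
    atom-ow : ∀ {s t} → t ∈ wrts s → t ∈ pend s →
              RegTrans r atomic s (ow t r) (uow s t (rec s t))
    atom-fr : ∀ {s t} → t ∈ rds s → t ∉ pend s →
              RegTrans r atomic s (fr t r (rec s t)) (ufr s t)
    atom-fw : ∀ {s t} → t ∈ wrts s → t ∉ pend s →
              RegTrans r atomic s (fw t r) (ufw s t (stor s))

  RegAlph : ℝ → Action → Set
  RegAlph r a = reg a ≡ just r

  regTrans⊆ : ∀ {k r s a s'} → RegTrans r k s a s' → RegAlph r a
  regTrans⊆ (start-r _ _)  = Relation.Binary.PropositionalEquality.refl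
  regTrans⊆ (start-w _ _)  = Relation.Binary.PropositionalEquality.refl
  regTrans⊆ (safe-fr₁ _ _) = Relation.Binary.PropositionalEquality.refl
  regTrans⊆ (safe-fr₂ _ _) = Relation.Binary.PropositionalEquality.refl
  regTrans⊆ (safe-fw₁ _ _) = Relation.Binary.PropositionalEquality.refl
  regTrans⊆ (safe-fw₂ _ _) = Relation.Binary.PropositionalEquality.refl
  regTrans⊆ (reg-fr _ _)   = Relation.Binary.PropositionalEquality.refl
  regTrans⊆ (reg-ow _ _)   = Relation.Binary.PropositionalEquality.refl
  regTrans⊆ (reg-fw _ _)   = Relation.Binary.PropositionalEquality.refl
  regTrans⊆ (atom-or _ _)  = Relation.Binary.PropositionalEquality.refl
  regTrans⊆ (atom-ow _ _)  = Relation.Binary.PropositionalEquality.refl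
  regTrans⊆ (atom-fr _ _)  = Relation.Binary.PropositionalEquality.refl
  regTrans⊆ (atom-fw _ _)  = Relation.Binary.PropositionalEquality.refl

  Register : Kind → ℝ → LTS Action
  Register k r = record
    { State = Status r ; init = initStatus r ; Alph = RegAlph r
    ; Trans = RegTrans r k ; trans⊆ = regTrans⊆ }

  ThreadAlph : 𝕋 → Action → Set
  ThreadAlph t (sr t' _)   = t' ≡ t
  ThreadAlph t (fr t' _ _) = t' ≡ t
  ThreadAlph t (sw t' _ _) = t' ≡ t
  ThreadAlph t (fw t' _)   = t' ≡ t
  ThreadAlph t (or _ _)    = ⊥
  ThreadAlph t (ow _ _)    = ⊥
  ThreadAlph t (loc t' _)  = t' ≡ t

  record PreThread (t : 𝕋) : Set₁ where
    field
      size   : ℕ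
      tinit  : Fin size
      ttrans : Fin size → Action → Fin size → Set
      ttrans⊆ : ∀ {s a s'} → ttrans s a s' → ThreadAlph t a

    lts : LTS Action
    lts = record { State = Fin size ; init = tinit ; Alph = ThreadAlph t
                 ; Trans = ttrans ; trans⊆ = ttrans⊆ }

    -- Run s m : a finite path of the LTS from its initial state ending in
    -- state s, where m is the action of its last step (nothing if it has
    -- no step).  These are exactly the positions on paths from init.
    data Run : Fin size → Maybe Action → Set where
      start : Run tinit nothing
      next  : ∀ {s m a s'} → Run s m → ttrans s a s' → Run s' (just a)

  record IsThread {t : 𝕋} (P : PreThread t) : Set where
    open PreThread P
    field
      after-sr : ∀ {s r} → Run s (just (sr t r)) →
                 ∀ a → Enabled lts s a ⇔ (Σ[ d ∈ D r ] a ≡ fr t r d)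
      after-sw : ∀ {s r d} → Run s (just (sw t r d)) →
                 ∀ a → Enabled lts s a ⇔ (a ≡ fw t r)
      fr-only  : ∀ {s m r d} → Run s m → Enabled lts s (fr t r d) →
                 m ≡ just (sr t r)
      fw-only  : ∀ {s m r} → Run s m → Enabled lts s (fw t r) →
                 Σ[ d ∈ D r ] m ≡ just (sw t r d)

  record Thread (t : 𝕋) : Set₁ where
    field
      pre      : PreThread t
      isThread : IsThread pre
    open PreThread pre public using (lts)

  record Model : Set₁ where
    field
      thread : (t : 𝕋) → Thread t
      kind   : ℝ → Kind

    T : 𝕋 → LTS Action
    T t = Thread.lts (thread t)

    component : 𝕋 ⊎ ℝ → LTS Action
    component (inj₁ t) = T t
    component (inj₂ r) = Register (kind r) r

    M : LTS Action
    M = Par component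

    _at_ : State M → (t : 𝕋) → State (T t)
    s at t = s (inj₁ t)

    -- π has a suffix on which no action of thread t occurs
    -- (equivalently: π contains only finitely many actions of t)
    FinitelyMany : Path M → 𝕋 → Set
    FinitelyMany π t = Σ[ k ∈ ℕ ] Σ[ k≤ ∈ k ≤ᴸ len π ]
                         NoneOn (suffix π k k≤) (λ b → thr b ≡ t)

    end : (π : Path M) (t : 𝕋) → FinitelyMany π t → State (T t)
    end π t (k , k≤ , _) = st (suffix π k k≤) 0 at t

    ThreadEnabled : Path M → Action → Set
    ThreadEnabled π a = Σ[ fm ∈ FinitelyMany π (thr a) ]
                          Enabled (T (thr a)) (end π (thr a) fm) a

-- In every reachable state, thread t is recorded as reading (writing)
-- register r exactly when the last action of T_t was sr_{t,r} (sw_{t,r}(d)),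
-- and a pending reader always has a possible value.  Hence a register can
-- always complete a pending operation, possibly by a register-local step.
-- So an action enabled in the T_t-component of a reachable state can be
-- replaced by an action of t that is enabled in M and is thread-local only
-- if it is the original one; conversely an action enabled in M can be so
-- replaced by one enabled in T_t (or/ow by the fr/fw the thread waits for).
-- As ⌣T only separates actions of different threads, both directions of the
-- equivalence reduce to these replacements on a suffix where t is silent.
module Submission where

open import Defs
open import Data.Nat using (zero; suc)
open import Data.Nat.Properties using (<⇒≤)
open import Data.Fin using (Fin; _≟_)
open import Data.Fin.Subset using (Subset; inside; outside; _∈_; _∉_; _∪_; ⁅_⁆)
open import Data.Fin.Subset.Properties using (x∈⁅x⁆; p⊆p∪q)
open import Data.Vec using (lookup; tabulate)
open import Data.Vec.Properties using (lookup∘update; lookup∘update′; lookup∘tabulate; []=⇒lookup; lookup⇒[]=)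
open import Data.Bool using (Bool; true; false; if_then_else_; _∧_)
open import Data.Maybe using (Maybe; just; nothing)
import Data.Maybe.Properties as Maybe
open import Data.Product using (Σ-syntax; _×_; _,_; proj₁; proj₂; uncurry)
open import Data.Sum using (_⊎_; inj₁; inj₂)
open import Data.Unit using (⊤; tt)
open import Data.Empty using (⊥; ⊥-elim)
open import Relation.Nullary using (¬_; Dec; yes; no)
open import Relation.Nullary.Decidable using (dec-true; dec-false)
open import Relation.Binary.PropositionalEquality using (_≡_; _≢_; refl; sym; trans; cong; cong₂; subst; module ≡-Reasoning)
open import Function.Bundles using (_⇔_; mk⇔; Equivalence)

module _ {A I : Set} (P : I → LTS A) where

  Par-step : ∀ {s a s'} → Trans (Par P) s a s' → ∀ i → Alph (P i) a →
             Trans (P i) (s i) a (s' i)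
  Par-step (_ , sync) i p = proj₂ (sync i) p

  Par-idle : ∀ {s a s'} → Trans (Par P) s a s' → ∀ i → ¬ Alph (P i) a → s' i ≡ s i
  Par-idle (_ , sync) i ¬p = proj₁ (sync i) ¬p

  Par-enabled : ∀ {s a} → (∀ i → Dec (Alph (P i) a)) → Σ[ i ∈ I ] Alph (P i) a →
                (∀ i → Alph (P i) a → Enabled (P i) (s i) a) → Enabled (Par P) s a
  Par-enabled {s} {a} alph? participant enabled =
    (λ i → target i (alph? i)) , participant , λ i → sync i (alph? i)
    where
      target : ∀ i → Dec (Alph (P i) a) → State (P i)
      target i (yes p) = proj₁ (enabled i p)
      target i (no _)  = s i

      sync : ∀ i (p? : Dec (Alph (P i) a)) →
             (¬ Alph (P i) a → target i p? ≡ s i) × (Alph (P i) a → Trans (P i) (s i) a (target i p?))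
      sync i (yes p) = (λ ¬p → ⊥-elim (¬p p)) , λ _ → proj₂ (enabled i p)
      sync i (no ¬p) = (λ _ → refl) , λ p → ⊥-elim (¬p p)

suc≤ᴸ⇒<ᴸ : ∀ {k} l → suc k ≤ᴸ l → k <ᴸ l
suc≤ᴸ⇒<ᴸ (fin n) k<n = k<n
suc≤ᴸ⇒<ᴸ inf     _   = tt

<ᴸ⇒≤ᴸ : ∀ {k} l → k <ᴸ l → k ≤ᴸ l
<ᴸ⇒≤ᴸ (fin n) k<n = <⇒≤ k<n
<ᴸ⇒≤ᴸ inf     _   = tt

invariant-along-path : ∀ {A} {L : LTS A} (Inv : State L → Set) → Inv (init L) →
  (∀ {s a s'} → Inv s → Trans L s a s' → Inv s') →
  (π : Path L) → st π 0 ≡ init L → ∀ k → k ≤ᴸ len π → Inv (st π k)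
invariant-along-path Inv inv₀ preserved π π₀ zero    _     = subst Inv (sym π₀) inv₀
invariant-along-path Inv inv₀ preserved π π₀ (suc k) k+1≤ =
  preserved (invariant-along-path Inv inv₀ preserved π π₀ k (<ᴸ⇒≤ᴸ (len π) k<))
            (step π k k<)
  where k< = suc≤ᴸ⇒<ᴸ (len π) k+1≤

module ThreadRegister (σ : Setting) where
  open Setting σ
  open TR σ
  open Status

  eqᵇ-refl : ∀ {n} (i : Fin n) → eqᵇ i i ≡ true
  eqᵇ-refl i = dec-true (i ≟ i) refl

  eqᵇ-≢ : ∀ {n} {i j : Fin n} → i ≢ j → eqᵇ i j ≡ false
  eqᵇ-≢ {i = i} {j} i≢j = dec-false (i ≟ j) i≢j

  eqᵇ⇒≡ : ∀ {n} {i j : Fin n} → eqᵇ i j ≡ true → i ≡ j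
  eqᵇ⇒≡ {i = i} {j} e with i ≟ j
  ... | yes i≡j = i≡j

  ∉-lookup : ∀ {n} (p : Subset n) i → lookup p i ≡ false → i ∉ p
  ∉-lookup p i e i∈p with trans (sym ([]=⇒lookup i∈p)) e
  ... | ()

  flags : ∀ {r} → Status r → 𝕋 → Bool × Bool
  flags x t = lookup (rds x) t , lookup (wrts x) t

  effect : Action → Bool × Bool → Bool × Bool
  effect (sr _ _)   (_ , w) = true , w
  effect (fr _ _ _) (_ , w) = false , w
  effect (sw _ _ _) (r , _) = r , true
  effect (fw _ _)   (r , _) = r , false
  effect _          f       = f

  data Update {r} (x : Status r) : Action → Status r → Set where
    by-usr : ∀ t → Update x (sr t r) (usr x t)
    by-ufr : ∀ t d → Update x (fr t r d) (ufr x t)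
    by-usw : ∀ t d → Update x (sw t r d) (usw x t d)
    by-ufw : ∀ t d → Update x (fw t r) (ufw x t d)
    by-uor : ∀ t → Update x (or t r) (uor x t)
    by-uow : ∀ t d → Update x (ow t r) (uow x t d)

  update : ∀ {r k x a y} → RegTrans r k x a y → Update x a y
  update (start-r _ _)  = by-usr _
  update (start-w _ _)  = by-usw _ _
  update (safe-fr₁ _ _) = by-ufr _ _
  update (safe-fr₂ _ _) = by-ufr _ _
  update (safe-fw₁ _ _) = by-ufw _ _
  update (safe-fw₂ _ _) = by-ufw _ _
  update (reg-fr _ _)   = by-ufr _ _
  update (reg-ow _ _)   = by-uow _ _
  update (reg-fw _ _)   = by-ufw _ _
  update (atom-or _ _)  = by-uor _
  update (atom-ow _ _)  = by-uow _ _
  update (atom-fr _ _)  = by-ufr _ _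
  update (atom-fw _ _)  = by-ufw _ _

  flags-update-own : ∀ {r} {x y : Status r} {a} → Update x a y →
                     flags y (thr a) ≡ effect a (flags x (thr a))
  flags-update-own {x = x} (by-usr t)   = cong (_, lookup (wrts x) t) (lookup∘update t (rds x) inside)
  flags-update-own {x = x} (by-ufr t _) = cong (_, lookup (wrts x) t) (lookup∘update t (rds x) outside)
  flags-update-own {x = x} (by-usw t _) = cong (lookup (rds x) t ,_) (lookup∘update t (wrts x) inside)
  flags-update-own {x = x} (by-ufw t _) = cong (lookup (rds x) t ,_) (lookup∘update t (wrts x) outside)
  flags-update-own (by-uor _)   = refl
  flags-update-own (by-uow _ _) = refl

  flags-update-other : ∀ {r} {x y : Status r} {a t} → Update x a y → t ≢ thr a →
                       flags y t ≡ flags x t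
  flags-update-other {x = x} {t = t} (by-usr _)   ne = cong (_, lookup (wrts x) t) (lookup∘update′ ne (rds x) inside)
  flags-update-other {x = x} {t = t} (by-ufr _ _) ne = cong (_, lookup (wrts x) t) (lookup∘update′ ne (rds x) outside)
  flags-update-other {x = x} {t = t} (by-usw _ _) ne = cong (lookup (rds x) t ,_) (lookup∘update′ ne (wrts x) inside)
  flags-update-other {x = x} {t = t} (by-ufw _ _) ne = cong (lookup (rds x) t ,_) (lookup∘update′ ne (wrts x) outside)
  flags-update-other (by-uor _)   _ = refl
  flags-update-other (by-uow _ _) _ = refl

  Readable : ∀ {r} → Status r → Set
  Readable {r} x = ∀ t → lookup (rds x) t ≡ true → Σ[ d ∈ D r ] d ∈ posvOf x t

  valuesOnRead : ∀ {r} → Status r → Subset (dsz r)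
  valuesOnRead x = ⁅ stor x ⁆ ∪ tabulate (λ d → anyFin (λ t' →
                     lookup (wrts x) t' ∧ eqᵇ (lookup (recv x) t') d))

  ∈-if-∪ : ∀ {n} {d : Fin n} b {p q : Subset n} → d ∈ p → d ∈ (if b then p else (p ∪ q))
  ∈-if-∪ true  d∈p = d∈p
  ∈-if-∪ false d∈p = p⊆p∪q _ d∈p

  readable-update : ∀ {r} {x y : Status r} {a} → Update x a y → Readable x → Readable y
  readable-update {x = x} (by-usr t₀) R t e with t ≟ t₀
  ... | yes refl = stor x , subst (stor x ∈_) (sym (lookup∘update t₀ (posv x) (valuesOnRead x)))
                                  (p⊆p∪q _ (x∈⁅x⁆ (stor x)))
  ... | no t≢t₀  = subst (λ p → Σ[ d ∈ _ ] d ∈ p) (sym (lookup∘update′ t≢t₀ (posv x) (valuesOnRead x)))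
                         (R t (trans (sym (lookup∘update′ t≢t₀ (rds x) inside)) e))
  readable-update {x = x} (by-usw t₀ d₀) R t e
    with d , d∈ ← R t e
    rewrite lookup∘tabulate (λ t' → if eqᵇ t' t₀ then posvOf x t' else (posvOf x t' ∪ ⁅ d₀ ⁆)) t
    = d , ∈-if-∪ (eqᵇ t t₀) d∈
  readable-update {x = x} (by-ufr t₀ _) R t e with t ≟ t₀
  ... | yes refl with () ← trans (sym (lookup∘update t₀ (rds x) outside)) e
  ... | no t≢t₀  = R t (trans (sym (lookup∘update′ t≢t₀ (rds x) outside)) e)
  readable-update (by-ufw _ _) R = R
  readable-update (by-uor _)   R = R
  readable-update (by-uow _ _) R = R

  read-completes : ∀ k {r} (x : Status r) t → lookup (rds x) t ≡ true → Readable x →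
    (Σ[ y ∈ Status r ] RegTrans r k x (or t r) y) ⊎
    (Σ[ d ∈ D r ] Σ[ y ∈ Status r ] RegTrans r k x (fr t r d) y)
  read-completes safe x t reading _ with ovrlOf x t in ov
  ... | false = inj₂ (_ , _ , safe-fr₁ (lookup⇒[]= t _ reading) ov)
  ... | true  = inj₂ (stor x , _ , safe-fr₂ (lookup⇒[]= t _ reading) ov)
  read-completes regular x t reading R with d , d∈ ← R t reading
    = inj₂ (d , _ , reg-fr (lookup⇒[]= t _ reading) d∈)
  read-completes atomic x t reading _ with lookup (pend x) t in pending
  ... | true  = inj₁ (_ , atom-or (lookup⇒[]= t _ reading) (lookup⇒[]= t _ pending))
  ... | false = inj₂ (_ , _ , atom-fr (lookup⇒[]= t _ reading) (∉-lookup _ t pending))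

  write-completes : ∀ k {r} (x : Status r) t → lookup (wrts x) t ≡ true →
    (Σ[ y ∈ Status r ] RegTrans r k x (ow t r) y) ⊎ (Σ[ y ∈ Status r ] RegTrans r k x (fw t r) y)
  write-completes safe x t writing with ovrlOf x t in ov
  ... | false = inj₂ (_ , safe-fw₁ (lookup⇒[]= t _ writing) ov)
  ... | true  = inj₂ (_ , safe-fw₂ {d = stor x} (lookup⇒[]= t _ writing) ov)
  write-completes regular x t writing with lookup (pend x) t in pending
  ... | true  = inj₁ (_ , reg-ow (lookup⇒[]= t _ writing) (lookup⇒[]= t _ pending))
  ... | false = inj₂ (_ , reg-fw (lookup⇒[]= t _ writing) (∉-lookup _ t pending))
  write-completes atomic x t writing with lookup (pend x) t in pending
  ... | true  = inj₁ (_ , atom-ow (lookup⇒[]= t _ writing) (lookup⇒[]= t _ pending))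
  ... | false = inj₂ (_ , atom-fw (lookup⇒[]= t _ writing) (∉-lookup _ t pending))

  idle⇒startable : ∀ {r} {x : Status r} {t} → flags x t ≡ (false , false) →
                   t ∉ rds x × t ∉ wrts x
  idle⇒startable {x = x} {t} idle =
    ∉-lookup (rds x) t (cong proj₁ idle) , ∉-lookup (wrts x) t (cong proj₂ idle)

  or⇒reading : ∀ {k r x y t} → RegTrans r k x (or t r) y → lookup (rds x) t ≡ true
  or⇒reading (atom-or t∈ _) = []=⇒lookup t∈

  ow⇒writing : ∀ {k r x y t} → RegTrans r k x (ow t r) y → lookup (wrts x) t ≡ true
  ow⇒writing (reg-ow t∈ _)  = []=⇒lookup t∈
  ow⇒writing (atom-ow t∈ _) = []=⇒lookup t∈

  ThreadAlph⇒thr : ∀ {t} a → ThreadAlph t a → thr a ≡ t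
  ThreadAlph⇒thr (sr _ _)   p = p
  ThreadAlph⇒thr (fr _ _ _) p = p
  ThreadAlph⇒thr (sw _ _ _) p = p
  ThreadAlph⇒thr (fw _ _)   p = p
  ThreadAlph⇒thr (loc _ _)  p = p

  ThreadAlph? : ∀ t a → Dec (ThreadAlph t a)
  ThreadAlph? t (sr t' _)   = t' ≟ t
  ThreadAlph? t (fr t' _ _) = t' ≟ t
  ThreadAlph? t (sw t' _ _) = t' ≟ t
  ThreadAlph? t (fw t' _)   = t' ≟ t
  ThreadAlph? t (or _ _)    = no λ ()
  ThreadAlph? t (ow _ _)    = no λ ()
  ThreadAlph? t (loc t' _)  = t' ≟ t

  effect-register-local : ∀ a → ¬ ThreadAlph (thr a) a → ∀ f → effect a f ≡ f
  effect-register-local (sr _ _)   ¬p = ⊥-elim (¬p refl)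
  effect-register-local (fr _ _ _) ¬p = ⊥-elim (¬p refl)
  effect-register-local (sw _ _ _) ¬p = ⊥-elim (¬p refl)
  effect-register-local (fw _ _)   ¬p = ⊥-elim (¬p refl)
  effect-register-local (or _ _)   _ _ = refl
  effect-register-local (ow _ _)   _ _ = refl
  effect-register-local (loc _ _)  ¬p = ⊥-elim (¬p refl)

  -- the register flags that the last action m of a thread leaves raised
  flagsOf : Maybe Action → ℝ → Bool × Bool
  flagsOf (just (sr _ r'))   r = eqᵇ r' r , false
  flagsOf (just (sw _ r' _)) r = false , eqᵇ r' r
  flagsOf _                  r = false , false

  Completion : Action → Set
  Completion (fr _ _ _) = ⊤
  Completion (fw _ _)   = ⊤
  Completion _          = ⊥

  Proxy : Action → Action → Set
  Proxy a b = thr b ≡ thr a × (ThreadLocal b → b ≡ a)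

  proxy-refl : ∀ {a} → Proxy a a
  proxy-refl = refl , λ _ → refl

  proxy-∉ : ∀ {B : Action → Set} → (∀ a → B a → ThreadLocal a) →
            ∀ {a b} → Proxy a b → ¬ B a → ¬ B b
  proxy-∉ {B} B⊆local (_ , local⇒≡) a∉B b∈B = a∉B (subst B (local⇒≡ (B⊆local _ b∈B)) b∈B)

  module Reachability (Mdl : Model) where
    open Model Mdl
    open ≡-Reasoning

    Run : (t : 𝕋) → State (T t) → Maybe Action → Set
    Run t = PreThread.Run (Thread.pre (thread t))

    private
      module IT t = IsThread (Thread.isThread (thread t))
      ttrans⊆ : ∀ {t x a x'} → Trans (T t) x a x' → ThreadAlph t a
      ttrans⊆ {t} = PreThread.ttrans⊆ (Thread.pre (thread t))

    run-thr : ∀ {t x a} → Run t x (just a) → thr a ≡ t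
    run-thr (PreThread.next _ tr) = ThreadAlph⇒thr _ (ttrans⊆ tr)

    idle-before : ∀ {t x m a} → Run t x m → Enabled (T t) x a → ¬ Completion a →
                  ∀ r → flagsOf m r ≡ (false , false)
    idle-before {m = nothing}           _   _  _ _ = refl
    idle-before {t} {m = just (sr _ _)} run en ¬c _ with refl ← run-thr run
      with _ , refl ← Equivalence.to (IT.after-sr t run _) en = ⊥-elim (¬c _)
    idle-before {t} {m = just (sw _ _ _)} run en ¬c _ with refl ← run-thr run
      with refl ← Equivalence.to (IT.after-sw t run _) en = ⊥-elim (¬c _)
    idle-before {m = just (fr _ _ _)} _ _ _ _ = refl
    idle-before {m = just (fw _ _)}   _ _ _ _ = refl
    idle-before {m = just (or _ _)}   _ _ _ _ = refl
    idle-before {m = just (ow _ _)}   _ _ _ _ = refl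
    idle-before {m = just (loc _ _)}  _ _ _ _ = refl

    reading⇒sr : ∀ {t x m r} → Run t x m → proj₁ (flagsOf m r) ≡ true → m ≡ just (sr t r)
    reading⇒sr {m = just (sr _ r')} {r} run e
      with refl ← run-thr run | refl ← eqᵇ⇒≡ {i = r'} {r} e = refl
    reading⇒sr {m = nothing}          _ ()
    reading⇒sr {m = just (fr _ _ _)}  _ ()
    reading⇒sr {m = just (sw _ _ _)}  _ ()
    reading⇒sr {m = just (fw _ _)}    _ ()
    reading⇒sr {m = just (or _ _)}    _ ()
    reading⇒sr {m = just (ow _ _)}    _ ()
    reading⇒sr {m = just (loc _ _)}   _ ()

    writing⇒sw : ∀ {t x m r} → Run t x m → proj₂ (flagsOf m r) ≡ true →
                 Σ[ d ∈ D r ] m ≡ just (sw t r d)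
    writing⇒sw {m = just (sw _ r' d)} {r} run e
      with refl ← run-thr run | refl ← eqᵇ⇒≡ {i = r'} {r} e = d , refl
    writing⇒sw {m = nothing}          _ ()
    writing⇒sw {m = just (sr _ _)}    _ ()
    writing⇒sw {m = just (fr _ _ _)}  _ ()
    writing⇒sw {m = just (fw _ _)}    _ ()
    writing⇒sw {m = just (or _ _)}    _ ()
    writing⇒sw {m = just (ow _ _)}    _ ()
    writing⇒sw {m = just (loc _ _)}   _ ()

    flagsOf-effect : ∀ {t x m a x' r} → Run t x m → Trans (T t) x a x' → reg a ≡ just r →
                     effect a (flagsOf m r) ≡ flagsOf (just a) r
    flagsOf-effect {a = sr _ r} run tr refl
      rewrite idle-before run (_ , tr) (λ ()) r | eqᵇ-refl r = refl
    flagsOf-effect {a = sw _ r _} run tr refl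
      rewrite idle-before run (_ , tr) (λ ()) r | eqᵇ-refl r = refl
    flagsOf-effect {t} {a = fr _ _ _} run tr refl with refl ← ttrans⊆ tr
      rewrite IT.fr-only t run (_ , tr) = refl
    flagsOf-effect {t} {a = fw _ _} run tr refl with refl ← ttrans⊆ tr
      with _ , refl ← IT.fw-only t run (_ , tr) = refl
    flagsOf-effect {a = or _ _} _ tr _ = ⊥-elim (ttrans⊆ tr)
    flagsOf-effect {a = ow _ _} _ tr _ = ⊥-elim (ttrans⊆ tr)
    flagsOf-effect {a = loc _ _} _ _ ()

    flagsOf-unaffected : ∀ {t x m a x' r} → Run t x m → Trans (T t) x a x' → reg a ≢ just r →
                         flagsOf m r ≡ flagsOf (just a) r
    flagsOf-unaffected {a = sr _ r'} {r = r} run tr ne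
      rewrite idle-before run (_ , tr) (λ ()) r | eqᵇ-≢ (λ r'≡r → ne (cong just r'≡r)) = refl
    flagsOf-unaffected {a = sw _ r' _} {r = r} run tr ne
      rewrite idle-before run (_ , tr) (λ ()) r | eqᵇ-≢ (λ r'≡r → ne (cong just r'≡r)) = refl
    flagsOf-unaffected {t} {a = fr _ r' _} run tr ne with refl ← ttrans⊆ tr
      rewrite IT.fr-only t run (_ , tr) | eqᵇ-≢ (λ r'≡r → ne (cong just r'≡r)) = refl
    flagsOf-unaffected {t} {a = fw _ r'} run tr ne with refl ← ttrans⊆ tr
      with _ , refl ← IT.fw-only t run (_ , tr)
      rewrite eqᵇ-≢ (λ r'≡r → ne (cong just r'≡r)) = refl
    flagsOf-unaffected {a = or _ _} _ tr _ = ⊥-elim (ttrans⊆ tr)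
    flagsOf-unaffected {a = ow _ _} _ tr _ = ⊥-elim (ttrans⊆ tr)
    flagsOf-unaffected {a = loc _ _} {r = r} run tr _ = idle-before run (_ , tr) (λ ()) r

    component-Alph? : ∀ i a → Dec (Alph (component i) a)
    component-Alph? (inj₁ t) a = ThreadAlph? t a
    component-Alph? (inj₂ r) a = Maybe.≡-dec _≟_ (reg a) (just r)

    M-enabled : ∀ {s a} → Σ[ i ∈ 𝕋 ⊎ ℝ ] Alph (component i) a →
                (∀ i → Alph (component i) a → Enabled (component i) (s i) a) → Enabled M s a
    M-enabled = Par-enabled component (λ i → component-Alph? i _)

    thread-step : ∀ {s a s' t} → Trans M s a s' → ThreadAlph t a → Trans (T t) (s at t) a (s' at t)
    thread-step tr = Par-step component tr (inj₁ _)

    register-step : ∀ {s a s' r} → Trans M s a s' → reg a ≡ just r →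
                    RegTrans r (kind r) (s (inj₂ r)) a (s' (inj₂ r))
    register-step tr = Par-step component tr (inj₂ _)

    Synchronised : State M → 𝕋 → Set
    Synchronised s t = Σ[ m ∈ Maybe Action ] Run t (s at t) m ×
                         (∀ r → flags (s (inj₂ r)) t ≡ flagsOf m r)

    record Invariant (s : State M) : Set where
      field
        synchronised : ∀ t → Synchronised s t
        readable     : ∀ r → Readable (s (inj₂ r))
    open Invariant

    invariant-init : Invariant (init M)
    invariant-init = record { synchronised = synchronised₀ ; readable = readable₀ }
      where
        nobody₀ : ∀ t → lookup (tabulate {n = nT} (λ _ → outside)) t ≡ false
        nobody₀ = lookup∘tabulate (λ _ → outside)

        synchronised₀ : ∀ t → Synchronised (init M) t
        synchronised₀ t = nothing , PreThread.start , λ r → cong₂ _,_ (nobody₀ t) (nobody₀ t)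

        readable₀ : ∀ r → Readable (initStatus r)
        readable₀ r t reading with () ← trans (sym (nobody₀ t)) reading

    flags-untouched : ∀ {s a s' t} → Trans M s a s' → ¬ ThreadAlph t a →
                      ∀ r → flags (s' (inj₂ r)) t ≡ flags (s (inj₂ r)) t
    flags-untouched {a = a} {t = t} tr ¬p r with component-Alph? (inj₂ r) a
    ... | no ¬q = cong (λ x → flags x t) (Par-idle component tr (inj₂ r) ¬q)
    ... | yes q with t ≟ thr a
    ...   | no t≢a   = flags-update-other (update (register-step tr q)) t≢a
    ...   | yes refl = trans (flags-update-own (update (register-step tr q)))
                             (effect-register-local a ¬p _)

    flags-after-step : ∀ {s a s' t m} → Trans M s a s' → (p : ThreadAlph t a) →
                       Run t (s at t) m → (∀ r → flags (s (inj₂ r)) t ≡ flagsOf m r) →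
                       ∀ r → flags (s' (inj₂ r)) t ≡ flagsOf (just a) r
    flags-after-step {s} {a} {s'} {m = m} tr p run synced r
      with refl ← ThreadAlph⇒thr a p | component-Alph? (inj₂ r) a
    ... | no ¬q = begin
      flags (s' (inj₂ r)) (thr a) ≡⟨ cong (λ x → flags x (thr a)) (Par-idle component tr (inj₂ r) ¬q) ⟩
      flags (s (inj₂ r)) (thr a)  ≡⟨ synced r ⟩
      flagsOf m r                 ≡⟨ flagsOf-unaffected run (thread-step tr p) ¬q ⟩
      flagsOf (just a) r          ∎
    ... | yes q = begin
      flags (s' (inj₂ r)) (thr a)          ≡⟨ flags-update-own (update (register-step tr q)) ⟩
      effect a (flags (s (inj₂ r)) (thr a)) ≡⟨ cong (effect a) (synced r) ⟩
      effect a (flagsOf m r)               ≡⟨ flagsOf-effect run (thread-step tr p) q ⟩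
      flagsOf (just a) r                   ∎

    invariant-step : ∀ {s a s'} → Invariant s → Trans M s a s' → Invariant s'
    invariant-step {s} {a} {s'} inv tr = record { synchronised = synchronised′ ; readable = readable′ }
      where
        readable′ : ∀ r → Readable (s' (inj₂ r))
        readable′ r with component-Alph? (inj₂ r) a
        ... | yes q = readable-update (update (register-step tr q)) (readable inv r)
        ... | no ¬q = subst Readable (sym (Par-idle component tr (inj₂ r) ¬q)) (readable inv r)

        synchronised′ : ∀ t → Synchronised s' t
        synchronised′ t with m , run , synced ← synchronised inv t | ThreadAlph? t a
        ... | yes p = just a , PreThread.next run (thread-step tr p) , flags-after-step tr p run synced
        ... | no ¬p = m , subst (λ x → Run t x m) (sym (Par-idle component tr (inj₁ t) ¬p)) run ,
                      λ r → trans (flags-untouched tr ¬p r) (synced r)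

    idle-thread : ∀ {s t a} → Invariant s → Enabled (T t) (s at t) a → ¬ Completion a →
                  ∀ r → t ∉ rds (s (inj₂ r)) × t ∉ wrts (s (inj₂ r))
    idle-thread {s} {t} inv en ¬c r with m , run , synced ← synchronised inv t =
      idle⇒startable {x = s (inj₂ r)} (trans (synced r) (idle-before run en ¬c r))

    thread-enabled⇒enabled : ∀ {s a} → Invariant s → Enabled (T (thr a)) (s at thr a) a →
                             Σ[ b ∈ Action ] Proxy a b × Enabled M s b
    thread-enabled⇒enabled {a = sr t r} inv en = sr t r , proxy-refl , M-enabled (inj₁ t , refl) λ
      { (inj₁ _) refl → en ; (inj₂ _) refl → _ , uncurry start-r (idle-thread inv en (λ ()) r) }
    thread-enabled⇒enabled {a = sw t r d} inv en = sw t r d , proxy-refl , M-enabled (inj₁ t , refl) λ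
      { (inj₁ _) refl → en ; (inj₂ _) refl → _ , uncurry start-w (idle-thread inv en (λ ()) r) }
    thread-enabled⇒enabled {s} {a = fr t r d} inv en with m , run , synced ← synchronised inv t
      with refl ← IT.fr-only t run en
      with read-completes (kind r) (s (inj₂ r)) t (trans (cong proj₁ (synced r)) (eqᵇ-refl r))
                          (readable inv r)
    ... | inj₁ (y , or-step) = or t r , (refl , λ ()) , M-enabled (inj₂ r , refl) λ
            { (inj₁ _) () ; (inj₂ _) refl → y , or-step }
    ... | inj₂ (d' , y , fr-step) = fr t r d' , (refl , λ ()) , M-enabled (inj₂ r , refl) λ
            { (inj₁ _) refl → Equivalence.from (IT.after-sr t run _) (d' , refl)
            ; (inj₂ _) refl → y , fr-step }
    thread-enabled⇒enabled {s} {a = fw t r} inv en with m , run , synced ← synchronised inv t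
      with d , refl ← IT.fw-only t run en
      with write-completes (kind r) (s (inj₂ r)) t (trans (cong proj₂ (synced r)) (eqᵇ-refl r))
    ... | inj₁ (y , ow-step) = ow t r , (refl , λ ()) , M-enabled (inj₂ r , refl) λ
            { (inj₁ _) () ; (inj₂ _) refl → y , ow-step }
    ... | inj₂ (y , fw-step) = fw t r , proxy-refl , M-enabled (inj₂ r , refl) λ
            { (inj₁ _) refl → en ; (inj₂ _) refl → y , fw-step }
    thread-enabled⇒enabled {a = loc t i} _ en = loc t i , proxy-refl , M-enabled (inj₁ t , refl) λ
      { (inj₁ _) refl → en ; (inj₂ _) () }
    thread-enabled⇒enabled {a = or _ _} _ (_ , tr) = ⊥-elim (ttrans⊆ tr)
    thread-enabled⇒enabled {a = ow _ _} _ (_ , tr) = ⊥-elim (ttrans⊆ tr)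

    enabled⇒thread-enabled : ∀ {s a} → Invariant s → Enabled M s a →
                             Σ[ b ∈ Action ] Proxy a b × Enabled (T (thr a)) (s at thr a) b
    enabled⇒thread-enabled {a = sr t r}   _ (_ , tr) = _ , proxy-refl , _ , thread-step tr refl
    enabled⇒thread-enabled {a = sw t r d} _ (_ , tr) = _ , proxy-refl , _ , thread-step tr refl
    enabled⇒thread-enabled {a = fr t r d} _ (_ , tr) = _ , proxy-refl , _ , thread-step tr refl
    enabled⇒thread-enabled {a = fw t r}   _ (_ , tr) = _ , proxy-refl , _ , thread-step tr refl
    enabled⇒thread-enabled {a = loc t i}  _ (_ , tr) = _ , proxy-refl , _ , thread-step tr refl
    enabled⇒thread-enabled {a = or t r} inv (_ , tr) with m , run , synced ← synchronised inv t
      with refl ← reading⇒sr run (trans (sym (cong proj₁ (synced r))) (or⇒reading (register-step tr refl)))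
      = fr t r (d0 r) , (refl , λ ()) , Equivalence.from (IT.after-sr t run _) (d0 r , refl)
    enabled⇒thread-enabled {a = ow t r} inv (_ , tr) with m , run , synced ← synchronised inv t
      with d , refl ← writing⇒sw run (trans (sym (cong proj₂ (synced r))) (ow⇒writing (register-step tr refl)))
      = fw t r , (refl , λ ()) , Equivalence.from (IT.after-sw t run _) refl

    module OnPath (π : Path M) (π₀ : st π 0 ≡ init M) where

      invariant-on : ∀ k → k ≤ᴸ len π → Invariant (st π k)
      invariant-on = invariant-along-path Invariant invariant-init invariant-step π π₀

      thread-enabled-by-silence : ∀ {t b} k (k≤ : k ≤ᴸ len π) →
        NoneOn (suffix π k k≤) (λ c → thr c ≡ t) → thr b ≡ t →
        Enabled (T t) (st π k at t) b → ThreadEnabled π b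
      thread-enabled-by-silence k k≤ silent refl en = (k , k≤ , silent) , en

      module _ {B : Action → Set} (B⊆local : ∀ a → B a → ThreadLocal a) where

        just⇒no-thread-enabled : Just _⌣T_ B π → ∀ a → ¬ B a → ¬ ThreadEnabled π a
        just⇒no-thread-enabled justness a a∉B ((k , k≤ , silent) , en)
          with b , b~a , b-enabled ← thread-enabled⇒enabled (invariant-on k k≤) en
          = justness k k≤ b (proxy-∉ B⊆local b~a a∉B) b-enabled
              λ j j< same-thread → same-thread λ b≡c → silent j j< (trans (sym b≡c) (proj₁ b~a))

        no-thread-enabled⇒just : (∀ a → ¬ B a → ¬ ThreadEnabled π a) → Just _⌣T_ B π
        no-thread-enabled⇒just none k k≤ a a∉B enabled silent
          with b , b~a , b-enabled ← enabled⇒thread-enabled (invariant-on k k≤) enabled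
          = none b (proxy-∉ B⊆local b~a a∉B)
              (thread-enabled-by-silence k k≤ (λ j j< c≡a → silent j j< λ a≢c → a≢c (sym c≡a))
                                         (proj₁ b~a) b-enabled)

proposition18 : (σ : Setting) (Mdl : TR.Model σ) (B : TR.Action σ → Set) →
    (∀ a → B a → TR.ThreadLocal σ a) →
    (π : Path (TR.Model.M Mdl)) → st π 0 ≡ init (TR.Model.M Mdl) →
    Just (TR._⌣T_ σ) B π ⇔ (∀ a → ¬ B a → ¬ TR.Model.ThreadEnabled Mdl π a)
proposition18 σ Mdl B B⊆local π π₀ =
  mk⇔ (just⇒no-thread-enabled B⊆local) (no-thread-enabled⇒just B⊆local)
  where open ThreadRegister.Reachability σ Mdl
        open OnPath π π₀
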